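{- Every orchard network $\mathcal N$ on $X$ is recoverable.
   Context: All paths are directed. A (binary) phylogenetic network $\mathcal N$ on a non-empty finite set $X$ is a rooted acyclic directed graph with no parallel arcs such that: the unique root has in-degree 0 and out-degree 2; the set of vertices of out-degree 0 is $X$ (the leaves), each of in-degree 1; every other vertex has either in-degree 1 and out-degree 2 (tree vertex) or in-degree 2 and out-degree 1 (reticulation). If $|X|=1$, $\mathcal N$ may also be the single vertex of $X$. For $|X|\ge 2$, $p_x$ is the parent of leaf $x$. $\{a,b\}$ is a cherry if $p_a=p_b$; $(a,b)$ is a reticulated cherry if $(p_a,p_b)$ is an arc with $p_b$ a reticulation and $p_a$ a tree vertex. Reducing $b$ of a cherry $\{a,b\}$: delete $b$ and its incident arc, suppress $p_a$ (if $p_a$ is the root, the result is the single vertex $a$). Cutting a reticulated cherry $(a,b)$: delete $(p_a,p_b)$ and suppress the resulting vertices of in-degree one and out-degree one. $\mathcal N$ is orchard if some sequence of such operations turns it into a single vertex. A stable ancestor of $X'\subseteq X$ is a vertex $u$ such that for every $x\in X'$ every path from the root to $x$ traverses $u$; ${\rm lsa}(X')$ is the unique stable ancestor of $X'$ with no other stable ancestor of $X'$ as a descendant. $\mathcal N$ is recoverable if ${\rm lsa}(X)$ is the root, i.e. no non-root vertex is a stable ancestor of $X$. -}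

module Defs where

open import Data.Nat using (ℕ; zero; suc)
open import Data.Bool using (Bool; true; false; if_then_else_; T)
open import Data.Fin using (Fin)
open import Data.List using (List; []; _∷_; map; allFin)
open import Data.Nat.ListAction using (sum)
open import Data.List.Membership.Propositional using (_∈_)
open import Data.Product using (Σ; ∃; _×_; _,_)
open import Data.Sum using (_⊎_)
open import Data.Empty using (⊥)
open import Relation.Binary.PropositionalEquality using (_≡_; _≢_)

-- A finite directed graph without parallel arcs: vertices Fin n,
-- arc relation given by a Boolean adjacency function.
record Graph : Set where
  field
    n   : ℕ
    arc : Fin n → Fin n → Bool

open Graph public

module _ (G : Graph) where

  Vertex : Set
  Vertex = Fin (n G)

  Arc : Vertex → Vertex → Set
  Arc u v = T (arc G u v)

  indeg : Vertex → ℕ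
  indeg v = sum (map (λ u → if arc G u v then 1 else 0) (allFin (n G)))

  outdeg : Vertex → ℕ
  outdeg u = sum (map (λ v → if arc G u v then 1 else 0) (allFin (n G)))

  data Path : Vertex → Vertex → Set where
    [] : ∀ {v} → Path v v
    _∷_ : ∀ {u v w} → Arc u v → Path v w → Path u w

  pathVertices : ∀ {u v} → Path u v → List Vertex
  pathVertices {v = v} [] = v ∷ []
  pathVertices {u = u} (_ ∷ p) = u ∷ pathVertices p

  Acyclic : Set
  Acyclic = ∀ u v → Arc u v → Path v u → ⊥

  IsRoot : Vertex → Set
  IsRoot r = indeg r ≡ 0

  -- leaves = vertices of out-degree 0 (the leaf set X)
  IsLeaf : Vertex → Set
  IsLeaf x = outdeg x ≡ 0

  IsTreeVertex : Vertex → Set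
  IsTreeVertex v = indeg v ≡ 1 × outdeg v ≡ 2

  IsReticulation : Vertex → Set
  IsReticulation v = indeg v ≡ 2 × outdeg v ≡ 1

  IsSingleVertex : Set
  IsSingleVertex = n G ≡ 1 × (∀ u v → Arc u v → ⊥)

  IsNetwork : Set
  IsNetwork =
    IsSingleVertex
    ⊎ (Acyclic
       × (Σ Vertex λ r →
            IsRoot r × outdeg r ≡ 2
            × (∀ v → IsRoot v → v ≡ r)
            × (∀ v → v ≢ r →
                 (indeg v ≡ 1 × outdeg v ≡ 0)
                 ⊎ IsTreeVertex v
                 ⊎ IsReticulation v)))

  StableAncestorOfX : Vertex → Vertex → Set
  StableAncestorOfX r u = ∀ x → IsLeaf x → (p : Path r x) → u ∈ pathVertices p

  Recoverable : Set
  Recoverable = ∀ r u → IsRoot r → StableAncestorOfX r u → u ≡ r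

record EmbedsMinus (N N' : Graph) (d₁ d₂ : Vertex N) : Set where
  field
    f     : Vertex N' → Vertex N
    inj   : ∀ i j → f i ≡ f j → i ≡ j
    avoid₁ : ∀ i → f i ≢ d₁
    avoid₂ : ∀ i → f i ≢ d₂
    onto  : ∀ v → v ≢ d₁ → v ≢ d₂ → ∃ λ i → f i ≡ v

-- N' is (isomorphic to) the result of reducing b of a cherry {a,b} of N
ReduceCherry : Graph → Graph → Set
ReduceCherry N N' =
  Σ (Vertex N) λ a → Σ (Vertex N) λ b → Σ (Vertex N) λ pa →
    a ≢ b × IsLeaf N a × IsLeaf N b × Arc N pa a × Arc N pa b
    × ( (IsRoot N pa × IsSingleVertex N')
      ⊎ (Σ (Vertex N) λ g → Arc N g pa
          × Σ (EmbedsMinus N N' b pa) λ E →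
              let open EmbedsMinus E in
              ∀ i j → (Arc N' i j → Arc N (f i) (f j) ⊎ (f i ≡ g × f j ≡ a))
                    × (Arc N (f i) (f j) ⊎ (f i ≡ g × f j ≡ a) → Arc N' i j)))

-- N' is (isomorphic to) the result of cutting a reticulated cherry (a,b) of N
CutReticulatedCherry : Graph → Graph → Set
CutReticulatedCherry N N' =
  Σ (Vertex N) λ a → Σ (Vertex N) λ b → Σ (Vertex N) λ pa → Σ (Vertex N) λ pb →
    IsLeaf N a × IsLeaf N b × Arc N pa a × Arc N pb b × Arc N pa pb
    × IsTreeVertex N pa × IsReticulation N pb
    × Σ (Vertex N) λ ga → Arc N ga pa
    × Σ (Vertex N) λ gb → Arc N gb pb × gb ≢ pa
    × Σ (EmbedsMinus N N' pa pb) λ E →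
        let open EmbedsMinus E in
        ∀ i j → (Arc N' i j → Arc N (f i) (f j) ⊎ (f i ≡ ga × f j ≡ a) ⊎ (f i ≡ gb × f j ≡ b))
              × (Arc N (f i) (f j) ⊎ (f i ≡ ga × f j ≡ a) ⊎ (f i ≡ gb × f j ≡ b) → Arc N' i j)

data Orchard : Graph → Set where
  done   : ∀ {N} → IsSingleVertex N → Orchard N
  reduce : ∀ {N N'} → ReduceCherry N N' → Orchard N' → Orchard N
  cut    : ∀ {N N'} → CutReticulatedCherry N N' → Orchard N' → Orchard N

-- A non-root stable ancestor u of the leaves survives every step of an orchard sequence. If the
-- step keeps u, every root-to-leaf path of the new network lifts to one of the old network, so u
-- stays a stable ancestor. If the step suppresses u, the unique kept child of u inherits this
-- property; the only suppressed vertex without a kept child is the removed leaf b of a cherry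
-- {a, b}, and b lies on no path to a. The sequence ends in the single-vertex network, which has
-- no vertex besides its root.

module Submission where

open import Defs
open import Data.Bool using (Bool; true; false; if_then_else_; T)
open import Data.Empty using (⊥; ⊥-elim)
open import Data.Fin using (Fin; zero; suc; _≟_; _<_)
open import Data.Fin.Properties using (any?; pigeonhole)
open import Data.List using (List; []; _∷_; map; allFin; tabulate; length; lookup)
open import Data.List.Properties using (map-tabulate)
open import Data.List.Membership.Propositional using (_∈_)
open import Data.List.Membership.Propositional.Properties using (∈-lookup)
open import Data.List.Relation.Unary.Any using (here; there)
import Data.List.Relation.Unary.All as All
open import Data.List.Relation.Unary.All.Properties using (¬Any⇒All¬)
open import Data.List.Relation.Unary.Unique.Propositional using (Unique; []; _∷_)
open import Data.Nat using (ℕ; zero; suc; _+_; _≤_; s≤s)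
open import Data.Nat.ListAction using (sum)
open import Data.Nat.Properties using (+-suc; 0≢1+n; ≰⇒>; n≮n; suc-injective; _≤?_)
open import Data.Product using (Σ; ∃; _×_; _,_; proj₁; proj₂)
open import Data.Sum using (_⊎_; inj₁; inj₂)
import Data.Sum as Sum
open import Function using (_∘_; id)
open import Relation.Nullary using (¬_; yes; no; does)
open import Relation.Nullary.Decidable.Core using (T?)
open import Relation.Binary.PropositionalEquality

indicator : Bool → ℕ
indicator b = if b then 1 else 0

countTrue : ∀ {n} → (Fin n → Bool) → ℕ
countTrue {zero}  h = 0
countTrue {suc n} h = indicator (h zero) + countTrue (h ∘ suc)

sum-indicator≡countTrue : ∀ {n} (h : Fin n → Bool) →
  sum (map (λ u → if h u then 1 else 0) (allFin n)) ≡ countTrue h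
sum-indicator≡countTrue h = trans (cong sum (map-tabulate id (indicator ∘ h))) (sum-tabulate h)
  where
  sum-tabulate : ∀ {n} (h : Fin n → Bool) → sum (tabulate (indicator ∘ h)) ≡ countTrue h
  sum-tabulate {zero}  h = refl
  sum-tabulate {suc n} h = cong (indicator (h zero) +_) (sum-tabulate (h ∘ suc))

-- does rather than ⌊_⌋, so that (h except suc x) ∘ suc reduces to (h ∘ suc) except x.
_except_ : ∀ {n} → (Fin n → Bool) → Fin n → Fin n → Bool
(h except x) u = if does (u ≟ x) then false else h u

except-≢ : ∀ {n} (h : Fin n → Bool) {x y} → y ≢ x → T (h y) → T ((h except x) y)
except-≢ h {x} {y} y≢x t with y ≟ x
... | yes y≡x = ⊥-elim (y≢x y≡x)
... | no _    = t

countTrue-except : ∀ {n} (h : Fin n → Bool) x → T (h x) → countTrue h ≡ suc (countTrue (h except x))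
countTrue-except h zero t with h zero
... | true = refl
countTrue-except h (suc x) t =
  trans (cong (indicator (h zero) +_) (countTrue-except (h ∘ suc) x t))
        (+-suc (indicator (h zero)) (countTrue ((h ∘ suc) except x)))

countTrue-except≡ : ∀ {n k} (h : Fin n → Bool) x → T (h x) →
  countTrue h ≡ suc k → countTrue (h except x) ≡ k
countTrue-except≡ h x t c = suc-injective (trans (sym (countTrue-except h x t)) c)

countTrue≡0⇒¬T : ∀ {n} (h : Fin n → Bool) → countTrue h ≡ 0 → ∀ x → ¬ T (h x)
countTrue≡0⇒¬T h c x t = 0≢1+n (trans (sym c) (countTrue-except h x t))

¬T⇒countTrue≡0 : ∀ {n} (h : Fin n → Bool) → (∀ x → ¬ T (h x)) → countTrue h ≡ 0
¬T⇒countTrue≡0 {zero}  h none = refl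
¬T⇒countTrue≡0 {suc n} h none with h zero | none zero
... | true  | ¬t = ⊥-elim (¬t _)
... | false | _  = ¬T⇒countTrue≡0 (h ∘ suc) (none ∘ suc)

countTrue≡suc⇒∃ : ∀ {n k} (h : Fin n → Bool) → countTrue h ≡ suc k → ∃ λ x → T (h x)
countTrue≡suc⇒∃ h c with any? (λ x → T? (h x))
... | yes found = found
... | no none   = ⊥-elim (0≢1+n (trans (sym (¬T⇒countTrue≡0 h λ x t → none (x , t))) c))

countTrue≡1⇒unique : ∀ {n} (h : Fin n → Bool) → countTrue h ≡ 1 →
  ∀ x y → T (h x) → T (h y) → x ≡ y
countTrue≡1⇒unique h c x y tx ty with y ≟ x
... | yes y≡x = sym y≡x
... | no y≢x  =
  ⊥-elim (countTrue≡0⇒¬T (h except x) (countTrue-except≡ h x tx c) y (except-≢ h y≢x ty))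

countTrue≡2⇒among : ∀ {n} (h : Fin n → Bool) → countTrue h ≡ 2 →
  ∀ x y → x ≢ y → T (h x) → T (h y) → ∀ z → T (h z) → z ≡ x ⊎ z ≡ y
countTrue≡2⇒among h c x y x≢y tx ty z tz with z ≟ x
... | yes z≡x = inj₁ z≡x
... | no z≢x  = inj₂ (countTrue≡1⇒unique (h except x) (countTrue-except≡ h x tx c) z y
                                         (except-≢ h z≢x tz) (except-≢ h (x≢y ∘ sym) ty))

fin-1-unique : ∀ {m} → m ≡ 1 → (x y : Fin m) → x ≡ y
fin-1-unique refl zero zero = refl

module _ (G : Graph) where

  Sink : Vertex G → Set
  Sink x = ∀ y → ¬ Arc G x y

  Source : Vertex G → Set
  Source y = ∀ x → ¬ Arc G x y

  AtMostOneParent : Vertex G → Set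
  AtMostOneParent v = ∀ p q → Arc G p v → Arc G q v → p ≡ q

  indeg≡countTrue : ∀ v → indeg G v ≡ countTrue (λ u → arc G u v)
  indeg≡countTrue v = sum-indicator≡countTrue (λ u → arc G u v)

  outdeg≡countTrue : ∀ v → outdeg G v ≡ countTrue (arc G v)
  outdeg≡countTrue v = sum-indicator≡countTrue (arc G v)

  isRoot⇒source : ∀ v → IsRoot G v → Source v
  isRoot⇒source v e = countTrue≡0⇒¬T _ (trans (sym (indeg≡countTrue v)) e)

  isLeaf⇒sink : ∀ v → IsLeaf G v → Sink v
  isLeaf⇒sink v e = countTrue≡0⇒¬T _ (trans (sym (outdeg≡countTrue v)) e)

  sink⇒isLeaf : ∀ v → Sink v → IsLeaf G v
  sink⇒isLeaf v sink = trans (outdeg≡countTrue v) (¬T⇒countTrue≡0 _ sink)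

  indeg≡suc⇒parent : ∀ {k} v → indeg G v ≡ suc k → ∃ λ p → Arc G p v
  indeg≡suc⇒parent v e = countTrue≡suc⇒∃ _ (trans (sym (indeg≡countTrue v)) e)

  outdeg≡suc⇒¬sink : ∀ {k} v → outdeg G v ≡ suc k → ¬ Sink v
  outdeg≡suc⇒¬sink v e sink with countTrue≡suc⇒∃ _ (trans (sym (outdeg≡countTrue v)) e)
  ... | y , vy = sink y vy

  indeg≡1⇒atMostOneParent : ∀ v → indeg G v ≡ 1 → AtMostOneParent v
  indeg≡1⇒atMostOneParent v e = countTrue≡1⇒unique _ (trans (sym (indeg≡countTrue v)) e)

  outdeg≡1⇒atMostOneChild : ∀ v → outdeg G v ≡ 1 → ∀ y z → Arc G v y → Arc G v z → y ≡ z
  outdeg≡1⇒atMostOneChild v e = countTrue≡1⇒unique _ (trans (sym (outdeg≡countTrue v)) e)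

  indeg≡2⇒parents-among : ∀ v → indeg G v ≡ 2 →
    ∀ p q → p ≢ q → Arc G p v → Arc G q v → ∀ s → Arc G s v → s ≡ p ⊎ s ≡ q
  indeg≡2⇒parents-among v e = countTrue≡2⇒among _ (trans (sym (indeg≡countTrue v)) e)

  outdeg≡2⇒children-among : ∀ v → outdeg G v ≡ 2 →
    ∀ x y → x ≢ y → Arc G v x → Arc G v y → ∀ z → Arc G v z → z ≡ x ⊎ z ≡ y
  outdeg≡2⇒children-among v e = countTrue≡2⇒among _ (trans (sym (outdeg≡countTrue v)) e)

  head∈pathVertices : ∀ {x y} (p : Path G x y) → x ∈ pathVertices G p
  head∈pathVertices []      = here refl
  head∈pathVertices (_ ∷ _) = here refl

  prefixTo : ∀ {x y u} (p : Path G x y) → u ∈ pathVertices G p → Path G x u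
  prefixTo []      (here refl)  = []
  prefixTo (_ ∷ _) (here refl)  = []
  prefixTo (e ∷ p) (there u∈p) = e ∷ prefixTo p u∈p

  suffixFrom : ∀ {x y u} (p : Path G x y) → u ∈ pathVertices G p → Path G u y
  suffixFrom []      (here refl)  = []
  suffixFrom (e ∷ p) (here refl)  = e ∷ p
  suffixFrom (_ ∷ p) (there u∈p) = suffixFrom p u∈p

  sink-path : ∀ {x y} → Sink x → Path G x y → x ≡ y
  sink-path sink []      = refl
  sink-path sink (e ∷ _) = ⊥-elim (sink _ e)

  acyclic⇒unique-vertices : Acyclic G → ∀ {x y} (p : Path G x y) → Unique (pathVertices G p)
  acyclic⇒unique-vertices acyclic []      = All.[] ∷ []
  acyclic⇒unique-vertices acyclic (e ∷ p) =
    ¬Any⇒All¬ _ (λ x∈p → acyclic _ _ e (prefixTo p x∈p)) ∷ acyclic⇒unique-vertices acyclic p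

unique-lookup : ∀ {A : Set} {xs : List A} → Unique xs →
  ∀ {i j} → i < j → lookup xs i ≢ lookup xs j
unique-lookup (x∉xs ∷ _) {zero}  {suc j} _          = All.lookup x∉xs (∈-lookup j)
unique-lookup (_ ∷ uniq) {suc i} {suc j} (s≤s i<j) = unique-lookup uniq i<j

unique⇒length≤ : ∀ {n} {xs : List (Fin n)} → Unique xs → length xs ≤ n
unique⇒length≤ {n} {xs} uniq with length xs ≤? n
... | yes ≤n = ≤n
... | no ≰n with pigeonhole (≰⇒> ≰n) (lookup xs)
... | i , j , i<j , eq = ⊥-elim (unique-lookup uniq i<j eq)

-- The part of IsNetwork carried through the induction: degrees would have to be recounted in
-- every reduced network, whereas these local consequences of the degree conditions transfer.
record WeakNetwork (G : Graph) : Set where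
  field
    root        : Vertex G
    root-source : Source G root
    has-parent  : ∀ v → v ≢ root → ∃ λ p → Arc G p v
    acyclic     : Acyclic G
    split       : ∀ v x y → x ≢ y → Arc G v x → Arc G v y →
                    (∀ z → Arc G v z → z ≡ x ⊎ z ≡ y) × AtMostOneParent G v
    sink-parent : ∀ v → Sink G v → AtMostOneParent G v

module _ {G : Graph} (W : WeakNetwork G) where
  open WeakNetwork W

  -- Walking up parent arcs either meets the root or yields a path with more than n G vertices.
  private
    ancestor-walk : ∀ k v → Path G root v ⊎
                    Σ (Vertex G) λ w → Σ (Path G w v) λ p → length (pathVertices G p) ≡ suc k
    ancestor-walk zero    v = inj₂ (v , [] , refl)
    ancestor-walk (suc k) v with ancestor-walk k v
    ... | inj₁ p = inj₁ p
    ... | inj₂ (w , p , len) with w ≟ root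
    ...   | yes refl = inj₁ p
    ...   | no w≢root with has-parent w w≢root
    ...     | q , e = inj₂ (q , e ∷ p , cong suc len)

  reachable : ∀ v → Path G root v
  reachable v with ancestor-walk (n G) v
  ... | inj₁ p = p
  ... | inj₂ (_ , p , len) =
    ⊥-elim (n≮n (n G) (subst (_≤ n G) len (unique⇒length≤ (acyclic⇒unique-vertices G acyclic p))))

StableAncestor : (G : Graph) → Vertex G → Vertex G → Set
StableAncestor G r u = ∀ x → Sink G x → (p : Path G r x) → u ∈ pathVertices G p

NonRootStableAncestor : ∀ {G} → WeakNetwork G → Set
NonRootStableAncestor {G} W = ∃ λ u → u ≢ root × StableAncestor G root u
  where open WeakNetwork W using (root)

stableAncestor-sink⇒≡ : ∀ {G r u} → StableAncestor G r u → Sink G u →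
                        ∀ x → Sink G x → Path G r x → u ≡ x
stableAncestor-sink⇒≡ {G} stable u-sink x x-sink p =
  sink-path G u-sink (suffixFrom G p (stable x x-sink p))

module _ (G : Graph) (acyclic : Acyclic G) (r : Vertex G) (r-root : IsRoot G r) (r-out : outdeg G r ≡ 2)
  (classify : ∀ v → v ≢ r →
     (indeg G v ≡ 1 × outdeg G v ≡ 0) ⊎ IsTreeVertex G v ⊎ IsReticulation G v) where

  network⇒weakNetwork : WeakNetwork G
  network⇒weakNetwork = record
    { root = r ; root-source = isRoot⇒source G r r-root ; has-parent = has-parent
    ; acyclic = acyclic ; split = split ; sink-parent = sink-parent }
    where
    has-parent : ∀ v → v ≢ r → ∃ λ p → Arc G p v
    has-parent v v≢r with classify v v≢r
    ... | inj₁ (in1 , _)        = indeg≡suc⇒parent G v in1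
    ... | inj₂ (inj₁ (in1 , _)) = indeg≡suc⇒parent G v in1
    ... | inj₂ (inj₂ (in2 , _)) = indeg≡suc⇒parent G v in2

    split : ∀ v x y → x ≢ y → Arc G v x → Arc G v y →
              (∀ z → Arc G v z → z ≡ x ⊎ z ≡ y) × AtMostOneParent G v
    split v x y x≢y vx vy with v ≟ r
    ... | yes refl = outdeg≡2⇒children-among G r r-out x y x≢y vx vy ,
                     λ p _ pr _ → ⊥-elim (isRoot⇒source G r r-root p pr)
    ... | no v≢r with classify v v≢r
    ...   | inj₁ (_ , out0)           = ⊥-elim (isLeaf⇒sink G v out0 x vx)
    ...   | inj₂ (inj₁ (in1 , out2)) = outdeg≡2⇒children-among G v out2 x y x≢y vx vy ,
                                       indeg≡1⇒atMostOneParent G v in1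
    ...   | inj₂ (inj₂ (_ , out1))   = ⊥-elim (x≢y (outdeg≡1⇒atMostOneChild G v out1 x y vx vy))

    sink-parent : ∀ v → Sink G v → AtMostOneParent G v
    sink-parent v sink with v ≟ r
    ... | yes refl = ⊥-elim (outdeg≡suc⇒¬sink G r r-out sink)
    ... | no v≢r with classify v v≢r
    ...   | inj₁ (in1 , _)          = indeg≡1⇒atMostOneParent G v in1
    ...   | inj₂ (inj₁ (_ , out2)) = ⊥-elim (outdeg≡suc⇒¬sink G v out2 sink)
    ...   | inj₂ (inj₂ (_ , out1)) = ⊥-elim (outdeg≡suc⇒¬sink G v out1 sink)

Removed : ∀ {A : Set} → A → A → A → Set
Removed d₁ d₂ v = v ≡ d₁ ⊎ v ≡ d₂

module _ {N N' : Graph} {d₁ d₂ : Vertex N} (E : EmbedsMinus N N' d₁ d₂) where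
  open EmbedsMinus E

  ArcsVia : (Vertex N → Vertex N → Set) → Set
  ArcsVia Shortcut = ∀ i j → (Arc N' i j → Arc N (f i) (f j) ⊎ Shortcut (f i) (f j))
                           × (Arc N (f i) (f j) ⊎ Shortcut (f i) (f j) → Arc N' i j)

  -- N' is N without d₁ and d₂, where each Shortcut x y is an arc of N' replacing a path
  -- x → d → y of N through a removed vertex d.
  record Suppression (W : WeakNetwork N) : Set₁ where
    open WeakNetwork W using (root)
    field
      Shortcut : Vertex N → Vertex N → Set
      arcs-via : ArcsVia Shortcut
      shortcut-via : ∀ x y → Shortcut x y → ∃ λ d → Removed d₁ d₂ d × Arc N x d × Arc N d y
      shortcut-kept : ∀ x y → Shortcut x y → ¬ Removed d₁ d₂ x × ¬ Removed d₁ d₂ y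
      shortcut-source-unique : ∀ x x' y → Shortcut x y → Shortcut x' y → x ≡ x'
      enter-removed : ∀ x d → ¬ Removed d₁ d₂ x → Removed d₁ d₂ d → Arc N x d →
                      ∃ λ y → Shortcut x y
      leave-removed : ∀ d y → Removed d₁ d₂ d → ¬ Removed d₁ d₂ y → Arc N d y →
                      ∃ λ x → Shortcut x y
      removed-kept-child-unique : ∀ d y z → Removed d₁ d₂ d → ¬ Removed d₁ d₂ y →
                                  ¬ Removed d₁ d₂ z → Arc N d y → Arc N d z → y ≡ z
      root-kept : ¬ Removed d₁ d₂ root
      stable-removed-has-kept-child : ∀ d → Removed d₁ d₂ d → StableAncestor N root d →
                                      ∃ λ y → ¬ Removed d₁ d₂ y × Arc N d y

module Suppressed {N N' : Graph} {d₁ d₂ : Vertex N} {E : EmbedsMinus N N' d₁ d₂} {W : WeakNetwork N}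
                  (S : Suppression E W) where
  open EmbedsMinus E
  open WeakNetwork W
  open Suppression S

  image-kept : ∀ i → ¬ Removed d₁ d₂ (f i)
  image-kept i (inj₁ e) = avoid₁ i e
  image-kept i (inj₂ e) = avoid₂ i e

  preimage : ∀ v → ¬ Removed d₁ d₂ v → ∃ λ i → f i ≡ v
  preimage v kept = onto v (kept ∘ inj₁) (kept ∘ inj₂)

  image-or-removed : ∀ v → (∃ λ i → f i ≡ v) ⊎ Removed d₁ d₂ v
  image-or-removed v with v ≟ d₁ | v ≟ d₂
  ... | yes v≡d₁ | _        = inj₂ (inj₁ v≡d₁)
  ... | no _     | yes v≡d₂ = inj₂ (inj₂ v≡d₂)
  ... | no v≢d₁  | no v≢d₂  = inj₁ (onto v v≢d₁ v≢d₂)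

  arc⇒ : ∀ i j → Arc N' i j → Arc N (f i) (f j) ⊎ Shortcut (f i) (f j)
  arc⇒ i j = proj₁ (arcs-via i j)

  direct-arc : ∀ i j → Arc N (f i) (f j) → Arc N' i j
  direct-arc i j = proj₂ (arcs-via i j) ∘ inj₁

  shortcut-arc : ∀ i j → Shortcut (f i) (f j) → Arc N' i j
  shortcut-arc i j = proj₂ (arcs-via i j) ∘ inj₂

  mutual
    lift : ∀ {i j} → Path N' i j → Path N (f i) (f j)
    lift []      = []
    lift (e ∷ p) = proj₁ (proj₂ (lift-step e p)) ∷ proj₂ (proj₂ (lift-step e p))

    lift-step : ∀ {i j k} → Arc N' i j → Path N' j k → ∃ λ w → Arc N (f i) w × Path N w (f k)
    lift-step {i} {j} e p with arc⇒ i j e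
    ... | inj₁ a = f j , a , lift p
    ... | inj₂ s with shortcut-via (f i) (f j) s
    ...   | d , _ , a₁ , a₂ = d , a₁ , a₂ ∷ lift p

  Origin : ∀ {i j} → Path N' i j → Vertex N → Set
  Origin p w = ∃ λ z → z ∈ pathVertices N' p × (f z ≡ w ⊎ Removed d₁ d₂ w × Arc N w (f z))

  mutual
    lift-origin : ∀ {i j w} (p : Path N' i j) → w ∈ pathVertices N (lift p) → Origin p w
    lift-origin []      (here refl) = _ , here refl , inj₁ refl
    lift-origin (e ∷ p) (here refl) = _ , here refl , inj₁ refl
    lift-origin (e ∷ p) (there w∈) with lift-step-origin e p w∈
    ... | z , z∈p , o = z , there z∈p , o

    lift-step-origin : ∀ {i j k w} (e : Arc N' i j) (p : Path N' j k) →
                       w ∈ pathVertices N (proj₂ (proj₂ (lift-step e p))) → Origin p w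
    lift-step-origin {i} {j} e p w∈ with arc⇒ i j e
    ... | inj₁ _ = lift-origin p w∈
    ... | inj₂ s with shortcut-via (f i) (f j) s
    ...   | d , removed , _ , a₂ with w∈
    ...     | here refl  = j , head∈pathVertices N' p , inj₂ (removed , a₂)
    ...     | there w∈′ = lift-origin p w∈′

  root′ : Vertex N'
  root′ = proj₁ (preimage root root-kept)

  f-root′ : f root′ ≡ root
  f-root′ = proj₂ (preimage root root-kept)

  private
    root-source′ : Source N' root′
    root-source′ v e with arc⇒ v root′ e
    ... | inj₁ a = root-source (f v) (subst (Arc N (f v)) f-root′ a)
    ... | inj₂ s with shortcut-via (f v) (f root′) s
    ...   | d , _ , _ , a₂ = root-source d (subst (Arc N d) f-root′ a₂)

    has-parent′ : ∀ v → v ≢ root′ → ∃ λ p → Arc N' p v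
    has-parent′ v v≢root′ with has-parent (f v) (λ e → v≢root′ (inj v root′ (trans e (sym f-root′))))
    ... | p , pv with image-or-removed p
    ...   | inj₁ (p′ , refl) = p′ , direct-arc p′ v pv
    ...   | inj₂ removed with leave-removed p (f v) removed (image-kept v) pv
    ...     | x , s with preimage x (proj₁ (shortcut-kept x (f v) s))
    ...       | x′ , refl = x′ , shortcut-arc x′ v s

    acyclic′ : Acyclic N'
    acyclic′ u v e p with lift-step e p
    ... | w , a , q = acyclic (f u) w a q

    sink′ : ∀ x → Sink N' x → Sink N (f x)
    sink′ x sink v a with image-or-removed v
    ... | inj₁ (v′ , refl) = sink v′ (direct-arc x v′ a)
    ... | inj₂ removed with enter-removed (f x) v (image-kept x) removed a
    ...   | y , s with preimage y (proj₂ (shortcut-kept (f x) y s))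
    ...     | y′ , refl = sink y′ (shortcut-arc x y′ s)

    direct-vs-shortcut : ∀ {p v x} → AtMostOneParent N (f v) →
                         Arc N (f p) (f v) → Shortcut x (f v) → ⊥
    direct-vs-shortcut {p} {v} {x} unique a s with shortcut-via x (f v) s
    ... | d , removed , _ , a₂ =
      image-kept p (subst (Removed d₁ d₂) (sym (unique (f p) d a a₂)) removed)

    atMostOneParent′ : ∀ v → AtMostOneParent N (f v) → AtMostOneParent N' v
    atMostOneParent′ v unique p q pv qv with arc⇒ p v pv | arc⇒ q v qv
    ... | inj₁ a | inj₁ b = inj p q (unique (f p) (f q) a b)
    ... | inj₁ a | inj₂ t = ⊥-elim (direct-vs-shortcut unique a t)
    ... | inj₂ s | inj₁ b = ⊥-elim (direct-vs-shortcut unique b s)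
    ... | inj₂ s | inj₂ t = inj p q (shortcut-source-unique (f p) (f q) (f v) s t)

    ChildImage : Vertex N' → Vertex N' → Set
    ChildImage v z = ∃ λ c → Arc N (f v) c × (f z ≡ c ⊎ Removed d₁ d₂ c × Arc N c (f z))

    child-image : ∀ v z → Arc N' v z → ChildImage v z
    child-image v z e with arc⇒ v z e
    ... | inj₁ a = f z , a , inj₁ refl
    ... | inj₂ s with shortcut-via (f v) (f z) s
    ...   | d , removed , a₁ , a₂ = d , a₁ , inj₂ (removed , a₂)

    child-image-injective : ∀ {v} y z (cy : ChildImage v y) (cz : ChildImage v z) →
                            proj₁ cy ≡ proj₁ cz → y ≡ z
    child-image-injective y z (_ , _ , inj₁ refl) (_ , _ , inj₁ refl) e = inj y z e
    child-image-injective y z (_ , _ , inj₁ refl) (_ , _ , inj₂ (removed , _)) refl =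
      ⊥-elim (image-kept y removed)
    child-image-injective y z (_ , _ , inj₂ (removed , _)) (_ , _ , inj₁ refl) refl =
      ⊥-elim (image-kept z removed)
    child-image-injective y z (c , _ , inj₂ (removed , cy)) (_ , _ , inj₂ (_ , cz)) refl =
      inj y z (removed-kept-child-unique c (f y) (f z) removed (image-kept y) (image-kept z) cy cz)

    split′ : ∀ v x y → x ≢ y → Arc N' v x → Arc N' v y →
               (∀ z → Arc N' v z → z ≡ x ⊎ z ≡ y) × AtMostOneParent N' v
    split′ v x y x≢y vx vy = children , atMostOneParent′ v (proj₂ split-f)
      where
      cx : ChildImage v x
      cx = child-image v x vx

      cy : ChildImage v y
      cy = child-image v y vy

      split-f : (∀ c → Arc N (f v) c → c ≡ proj₁ cx ⊎ c ≡ proj₁ cy) × AtMostOneParent N (f v)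
      split-f = split (f v) (proj₁ cx) (proj₁ cy) (x≢y ∘ child-image-injective x y cx cy)
                      (proj₁ (proj₂ cx)) (proj₁ (proj₂ cy))

      children : ∀ z → Arc N' v z → z ≡ x ⊎ z ≡ y
      children z vz =
        Sum.map (child-image-injective z x cz cx) (child-image-injective z y cz cy)
                (proj₁ split-f (proj₁ cz) (proj₁ (proj₂ cz)))
        where
        cz : ChildImage v z
        cz = child-image v z vz

  weakNetwork : WeakNetwork N'
  weakNetwork = record
    { root = root′ ; root-source = root-source′ ; has-parent = has-parent′ ; acyclic = acyclic′
    ; split = split′
    ; sink-parent = λ v sink → atMostOneParent′ v (sink-parent (f v) (sink′ v sink)) }

  private
    stable-origin : ∀ {u} → StableAncestor N root u →
                    ∀ x → Sink N' x → (p : Path N' root′ x) → Origin p u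
    stable-origin {u} stable x sink p =
      lift-origin p (subst (λ r → StableAncestor N r u) (sym f-root′) stable
                           (f x) (sink′ x sink) (lift p))

  nonRootStableAncestor : NonRootStableAncestor W → NonRootStableAncestor weakNetwork
  nonRootStableAncestor (u , u≢root , stable) with image-or-removed u
  ... | inj₁ (u′ , refl) =
    u′ , (λ e → u≢root (trans (cong f e) f-root′)) ,
    λ x sink p → kept (stable-origin stable x sink p)
    where
    kept : ∀ {i j} {p : Path N' i j} → Origin p (f u′) → u′ ∈ pathVertices N' p
    kept (z , z∈p , inj₁ e)            = subst (_∈ _) (inj z u′ e) z∈p
    kept (_ , _ , inj₂ (removed , _)) = ⊥-elim (image-kept u′ removed)
  ... | inj₂ removed with stable-removed-has-kept-child u removed stable
  ...   | y , y-kept , uy with preimage y y-kept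
  ...     | k , refl = k , (λ e → root-source u (subst (Arc N u) (trans (cong f e) f-root′) uy)) ,
                       λ x sink p → escaped (stable-origin stable x sink p)
    where
    escaped : ∀ {i j} {p : Path N' i j} → Origin p u → k ∈ pathVertices N' p
    escaped (z , _ , inj₁ refl)      = ⊥-elim (image-kept z removed)
    escaped (z , z∈p , inj₂ (_ , uz)) =
      subst (_∈ _) (inj z k (removed-kept-child-unique u (f z) (f k) removed
                                                  (image-kept z) (image-kept k) uz uy)) z∈p

module _ {N : Graph} (W : WeakNetwork N) where
  open WeakNetwork W

  no-loop : ∀ {x} → ¬ Arc N x x
  no-loop a = acyclic _ _ a []

  cherry-at-root : ∀ a b pa → a ≢ b → IsLeaf N a → IsLeaf N b → Arc N pa a → Arc N pa b →
                   IsRoot N pa → ¬ NonRootStableAncestor W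
  cherry-at-root a b pa a≢b a-leaf b-leaf pa→a pa→b pa-root (u , u≢root , stable) with pa ≟ root
  ... | yes refl = a≢b (trans (sym (child-of-root a a-leaf pa→a)) (child-of-root b b-leaf pa→b))
    where
    child-of-root : ∀ x → IsLeaf N x → Arc N root x → u ≡ x
    child-of-root x x-leaf e with stable x (isLeaf⇒sink N x x-leaf) (e ∷ [])
    ... | here u≡root       = ⊥-elim (u≢root u≡root)
    ... | there (here u≡x) = u≡x
  ... | no pa≢root = isRoot⇒source N pa pa-root _ (proj₂ (has-parent pa pa≢root))

  module _ {N' : Graph} (a b pa g : Vertex N) (a≢b : a ≢ b) (a-leaf : IsLeaf N a) (b-leaf : IsLeaf N b)
           (pa→a : Arc N pa a) (pa→b : Arc N pa b) (g→pa : Arc N g pa)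
           (E : EmbedsMinus N N' b pa) (arcs : ArcsVia E λ x y → x ≡ g × y ≡ a) where

    private
      a-sink : Sink N a
      a-sink = isLeaf⇒sink N a a-leaf

      b-sink : Sink N b
      b-sink = isLeaf⇒sink N b b-leaf

      pa-children : ∀ z → Arc N pa z → z ≡ a ⊎ z ≡ b
      pa-children = proj₁ (split pa a b a≢b pa→a pa→b)

      pa-parent : ∀ x → Arc N x pa → x ≡ g
      pa-parent x x→pa = proj₂ (split pa a b a≢b pa→a pa→b) x g x→pa g→pa

      a-kept : ¬ Removed b pa a
      a-kept (inj₁ a≡b)  = a≢b a≡b
      a-kept (inj₂ refl) = a-sink a pa→a

      g-kept : ¬ Removed b pa g
      g-kept (inj₁ refl) = b-sink pa g→pa
      g-kept (inj₂ refl) = no-loop g→pa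

      kept-child-of-pa : ∀ y → ¬ Removed b pa y → Arc N pa y → y ≡ a
      kept-child-of-pa y y-kept pa→y with pa-children y pa→y
      ... | inj₁ y≡a  = y≡a
      ... | inj₂ refl = ⊥-elim (y-kept (inj₁ refl))

    reduce-suppression : Suppression E W
    reduce-suppression = record
      { Shortcut = λ x y → x ≡ g × y ≡ a
      ; arcs-via = arcs
      ; shortcut-via = λ { _ _ (refl , refl) → pa , inj₂ refl , g→pa , pa→a }
      ; shortcut-kept = λ { _ _ (refl , refl) → g-kept , a-kept }
      ; shortcut-source-unique = λ { _ _ _ (refl , _) (refl , _) → refl }
      ; enter-removed = λ
          { x _ x-kept (inj₁ refl) x→b →
              ⊥-elim (x-kept (inj₂ (sink-parent b b-sink x pa x→b pa→b)))
          ; x _ _      (inj₂ refl) x→pa → a , pa-parent x x→pa , refl }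
      ; leave-removed = λ
          { _ y (inj₁ refl) _ b→y → ⊥-elim (b-sink y b→y)
          ; _ y (inj₂ refl) y-kept pa→y → g , refl , kept-child-of-pa y y-kept pa→y }
      ; removed-kept-child-unique = λ
          { _ y _ (inj₁ refl) _ _ b→y _ → ⊥-elim (b-sink y b→y)
          ; _ y z (inj₂ refl) y-kept z-kept pa→y pa→z →
              trans (kept-child-of-pa y y-kept pa→y) (sym (kept-child-of-pa z z-kept pa→z)) }
      ; root-kept = λ { (inj₁ refl) → root-source pa pa→b ; (inj₂ refl) → root-source g g→pa }
      ; stable-removed-has-kept-child = λ
          { _ (inj₁ refl) stable →
              ⊥-elim (a≢b (sym (stableAncestor-sink⇒≡ stable b-sink a a-sink (reachable W a))))
          ; _ (inj₂ refl) _ → a , a-kept , pa→a }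
      }

  module _ {N' : Graph} (a b pa pb ga gb : Vertex N) (a-leaf : IsLeaf N a) (b-leaf : IsLeaf N b)
           (pa→a : Arc N pa a) (pb→b : Arc N pb b) (pa→pb : Arc N pa pb) (pb-ret : IsReticulation N pb)
           (ga→pa : Arc N ga pa) (gb→pb : Arc N gb pb) (gb≢pa : gb ≢ pa)
           (E : EmbedsMinus N N' pa pb)
           (arcs : ArcsVia E λ x y → (x ≡ ga × y ≡ a) ⊎ (x ≡ gb × y ≡ b)) where

    private
      a-sink : Sink N a
      a-sink = isLeaf⇒sink N a a-leaf

      b-sink : Sink N b
      b-sink = isLeaf⇒sink N b b-leaf

      a≢pb : a ≢ pb
      a≢pb refl = a-sink b pb→b

      pa-children : ∀ z → Arc N pa z → z ≡ a ⊎ z ≡ pb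
      pa-children = proj₁ (split pa a pb a≢pb pa→a pa→pb)

      pa-parent : ∀ x → Arc N x pa → x ≡ ga
      pa-parent x x→pa = proj₂ (split pa a pb a≢pb pa→a pa→pb) x ga x→pa ga→pa

      pb-parents : ∀ x → Arc N x pb → x ≡ pa ⊎ x ≡ gb
      pb-parents = indeg≡2⇒parents-among N pb (proj₁ pb-ret) pa gb (gb≢pa ∘ sym) pa→pb gb→pb

      pb-child : ∀ y → Arc N pb y → y ≡ b
      pb-child y pb→y = outdeg≡1⇒atMostOneChild N pb (proj₂ pb-ret) y b pb→y pb→b

      a≢b : a ≢ b
      a≢b refl = no-loop (subst (Arc N pa) (sink-parent a a-sink pb pa pb→b pa→a) pa→pb)

      a-kept : ¬ Removed pa pb a
      a-kept (inj₁ refl) = a-sink a pa→a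
      a-kept (inj₂ a≡pb) = a≢pb a≡pb

      b-kept : ¬ Removed pa pb b
      b-kept (inj₁ refl) = b-sink a pa→a
      b-kept (inj₂ refl) = b-sink b pb→b

      ga-kept : ¬ Removed pa pb ga
      ga-kept (inj₁ refl) = no-loop ga→pa
      ga-kept (inj₂ refl) = acyclic pa ga pa→pb (ga→pa ∷ [])

      gb-kept : ¬ Removed pa pb gb
      gb-kept (inj₁ gb≡pa) = gb≢pa gb≡pa
      gb-kept (inj₂ refl)  = no-loop gb→pb

      kept-child-of-pa : ∀ y → ¬ Removed pa pb y → Arc N pa y → y ≡ a
      kept-child-of-pa y y-kept pa→y with pa-children y pa→y
      ... | inj₁ y≡a  = y≡a
      ... | inj₂ refl = ⊥-elim (y-kept (inj₂ refl))

      kept-parent-of-pb : ∀ x → ¬ Removed pa pb x → Arc N x pb → x ≡ gb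
      kept-parent-of-pb x x-kept x→pb with pb-parents x x→pb
      ... | inj₁ refl = ⊥-elim (x-kept (inj₁ refl))
      ... | inj₂ x≡gb = x≡gb

    cut-suppression : Suppression E W
    cut-suppression = record
      { Shortcut = λ x y → (x ≡ ga × y ≡ a) ⊎ (x ≡ gb × y ≡ b)
      ; arcs-via = arcs
      ; shortcut-via = λ
          { _ _ (inj₁ (refl , refl)) → pa , inj₁ refl , ga→pa , pa→a
          ; _ _ (inj₂ (refl , refl)) → pb , inj₂ refl , gb→pb , pb→b }
      ; shortcut-kept = λ
          { _ _ (inj₁ (refl , refl)) → ga-kept , a-kept
          ; _ _ (inj₂ (refl , refl)) → gb-kept , b-kept }
      ; shortcut-source-unique = λ
          { _ _ _ (inj₁ (refl , refl)) (inj₁ (refl , _))  → refl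
          ; _ _ _ (inj₁ (refl , refl)) (inj₂ (_ , a≡b))  → ⊥-elim (a≢b a≡b)
          ; _ _ _ (inj₂ (refl , refl)) (inj₁ (_ , b≡a))  → ⊥-elim (a≢b (sym b≡a))
          ; _ _ _ (inj₂ (refl , refl)) (inj₂ (refl , _)) → refl }
      ; enter-removed = λ
          { x _ _ (inj₁ refl) x→pa → a , inj₁ (pa-parent x x→pa , refl)
          ; x _ x-kept (inj₂ refl) x→pb → b , inj₂ (kept-parent-of-pb x x-kept x→pb , refl) }
      ; leave-removed = λ
          { _ y (inj₁ refl) y-kept pa→y → ga , inj₁ (refl , kept-child-of-pa y y-kept pa→y)
          ; _ y (inj₂ refl) _ pb→y → gb , inj₂ (refl , pb-child y pb→y) }
      ; removed-kept-child-unique = λ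
          { _ y z (inj₁ refl) y-kept z-kept pa→y pa→z →
              trans (kept-child-of-pa y y-kept pa→y) (sym (kept-child-of-pa z z-kept pa→z))
          ; _ y z (inj₂ refl) _ _ pb→y pb→z → trans (pb-child y pb→y) (sym (pb-child z pb→z)) }
      ; root-kept = λ { (inj₁ refl) → root-source ga ga→pa ; (inj₂ refl) → root-source pa pa→pb }
      ; stable-removed-has-kept-child = λ
          { _ (inj₁ refl) _ → a , a-kept , pa→a
          ; _ (inj₂ refl) _ → b , b-kept , pb→b }
      }

orchard⇒¬nonRootStableAncestor : ∀ {N} → Orchard N → (W : WeakNetwork N) → ¬ NonRootStableAncestor W
orchard⇒¬nonRootStableAncestor (done single) W (u , u≢root , _) =
  u≢root (fin-1-unique (proj₁ single) u _)
orchard⇒¬nonRootStableAncestor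
  (reduce (a , b , pa , a≢b , a-leaf , b-leaf , pa→a , pa→b , inj₁ (pa-root , _)) _) W =
  cherry-at-root W a b pa a≢b a-leaf b-leaf pa→a pa→b pa-root
orchard⇒¬nonRootStableAncestor
  (reduce (a , b , pa , a≢b , a-leaf , b-leaf , pa→a , pa→b , inj₂ (g , g→pa , E , arcs))
          N′-orchard) W =
  orchard⇒¬nonRootStableAncestor N′-orchard (Suppressed.weakNetwork S)
  ∘ Suppressed.nonRootStableAncestor S
  where
  S : Suppression E W
  S = reduce-suppression W a b pa g a≢b a-leaf b-leaf pa→a pa→b g→pa E arcs
orchard⇒¬nonRootStableAncestor
  (cut (a , b , pa , pb , a-leaf , b-leaf , pa→a , pb→b , pa→pb , _ , pb-ret ,
        ga , ga→pa , gb , gb→pb , gb≢pa , E , arcs) N′-orchard) W =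
  orchard⇒¬nonRootStableAncestor N′-orchard (Suppressed.weakNetwork S)
  ∘ Suppressed.nonRootStableAncestor S
  where
  S : Suppression E W
  S = cut-suppression W a b pa pb ga gb a-leaf b-leaf pa→a pb→b pa→pb pb-ret ga→pa gb→pb gb≢pa E arcs

lemma3p1 : (N : Graph) → IsNetwork N → Orchard N → Recoverable N
lemma3p1 N (inj₁ single) _ r u _ _ = fin-1-unique (proj₁ single) u r
lemma3p1 N (inj₂ (acyclic , r₀ , r₀-root , r₀-out , root-unique , classify)) orchard r u r-root stable
  with root-unique r r-root | u ≟ r
... | refl | yes u≡r = u≡r
... | refl | no u≢r  =
  ⊥-elim (orchard⇒¬nonRootStableAncestor orchard W (u , u≢r , stable-at-sinks))
  where
  W : WeakNetwork N
  W = network⇒weakNetwork N acyclic r r₀-root r₀-out classify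
  stable-at-sinks : StableAncestor N r u
  stable-at-sinks x sink = stable x (sink⇒isLeaf N x sink)
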